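{- If $G$ is a graph of order $n\geq 3$ having a universal vertex (a vertex adjacent to all other vertices), then $\mathrm{msd}_{\gamma_t}(G)=2$.
   Context: A set $S\subseteq V(G)$ is a total dominating set of $G$ if every vertex of $G$ is adjacent to a vertex of $S$; $\gamma_t(G)$ is the minimum size of such a set. For an edge $e=uv$ and integer $t\ge1$, $G_{e,t}$ denotes the graph obtained from $G$ by replacing the edge $uv$ by a path $(u,x_1,\dots,x_t,v)$ with $t$ new vertices. For an edge $uv$, $\mathrm{msd}_{\gamma_t}(uv)$ is the minimum positive integer $t$ such that $\gamma_t(G_{uv,t})>\gamma_t(G)$, and the total domination multisubdivision number is $\mathrm{msd}_{\gamma_t}(G)=\min\{\mathrm{msd}_{\gamma_t}(uv): uv\in E(G)\}$. -}

module Defs where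

open import Data.Nat using (ℕ; zero; suc; _+_; _≤_; _<_; _≡ᵇ_)
open import Data.Fin using (Fin; toℕ; splitAt; _≟_)
open import Data.Fin.Subset using (Subset; _∈_; ∣_∣)
open import Data.Bool using (Bool; true; false; _∧_; _∨_; not)
open import Data.Maybe using (Maybe; just; nothing)
open import Data.Sum using (_⊎_; inj₁; inj₂)
open import Data.Product using (Σ; _×_; ∃; ∃-syntax; _,_)
open import Relation.Nullary using (¬_)
open import Relation.Nullary.Decidable using (⌊_⌋)
open import Relation.Binary.PropositionalEquality using (_≡_; _≢_)

Adjacency : ℕ → Set
Adjacency n = Fin n → Fin n → Bool

record Graph (n : ℕ) : Set where
  field
    Adj    : Adjacency n
    sym    : ∀ i j → Adj i j ≡ Adj j i
    irrefl : ∀ i → Adj i i ≡ false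
open Graph public

IsTDS : ∀ {n} → Adjacency n → Subset n → Set
IsTDS {n} A S = ∀ (x : Fin n) → ∃[ y ] (y ∈ S × A x y ≡ true)

IsGammaT : ∀ {n} → Adjacency n → ℕ → Set
IsGammaT {n} A k =
  (∃[ S ] (IsTDS A S × ∣ S ∣ ≡ k)) × (∀ (S : Subset n) → IsTDS A S → k ≤ ∣ S ∣)

-- Subdivision G_{uv,t}: vertex set Fin (n + t); the first n vertices are the
-- original ones, the vertex n + (k-1) is x_k (k = 1..t).  The edge uv is
-- replaced by the path (u, x_1, ..., x_t, v).
module _ {n : ℕ} (A : Adjacency n) (u v : Fin n) (t : ℕ) where

  private
    eqF : Fin n → Fin n → Bool
    eqF a b = ⌊ a ≟ b ⌋

    isUV : Fin n → Fin n → Bool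
    isUV a b = (eqF a u ∧ eqF b v) ∨ (eqF a v ∧ eqF b u)

    -- position on the path (u = 0, x_k = k, v = t+1); other vertices: none
    pos : Fin n ⊎ Fin t → Maybe ℕ
    pos (inj₁ a) with eqF a u | eqF a v
    ... | true  | _     = just 0
    ... | false | true  = just (suc t)
    ... | false | false = nothing
    pos (inj₂ k) = just (suc (toℕ k))

    pathAdj : Maybe ℕ → Maybe ℕ → Bool
    pathAdj (just p) (just q) = (p ≡ᵇ suc q) ∨ (q ≡ᵇ suc p)
    pathAdj _        _        = false

    oldAdj : Fin n ⊎ Fin t → Fin n ⊎ Fin t → Bool
    oldAdj (inj₁ a) (inj₁ b) = A a b ∧ not (isUV a b)
    oldAdj _        _        = false

    adj' : Fin n ⊎ Fin t → Fin n ⊎ Fin t → Bool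
    adj' a b = oldAdj a b ∨ pathAdj (pos a) (pos b)

  subdivide : Adjacency (n + t)
  subdivide a b = adj' (splitAt n a) (splitAt n b)

Increases : ∀ {n} → Graph n → Fin n → Fin n → ℕ → Set
Increases G u v t =
  ∃[ k ] ∃[ k' ] (IsGammaT (Adj G) k × IsGammaT (subdivide (Adj G) u v t) k' × k < k')

IsMsdEdge : ∀ {n} → Graph n → Fin n → Fin n → ℕ → Set
IsMsdEdge G u v t =
  1 ≤ t × Increases G u v t × (∀ s → 1 ≤ s → s < t → ¬ Increases G u v s)

IsMsd : ∀ {n} → Graph n → ℕ → Set
IsMsd {n} G m =
  (∃[ u ] ∃[ v ] (Adj G u v ≡ true × IsMsdEdge G u v m))
  × (∀ (u v : Fin n) → Adj G u v ≡ true → ∀ t → IsMsdEdge G u v t → m ≤ t)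

IsUniversal : ∀ {n} → Graph n → Fin n → Set
IsUniversal {n} G w = ∀ (x : Fin n) → x ≢ w → Adj G w x ≡ true

-- A universal vertex w gives γₜ(G) = 2: {w, v} is total dominating, and every total
-- dominating set contains two adjacent, hence distinct, vertices. Subdividing any edge uv
-- once keeps γₜ ≤ 2, via {w, x₁} if w is an endpoint of uv and {w, u} otherwise, so no
-- edge has msd 1. Subdividing the edge wv twice forces γₜ = 3: the dominators of x₁ and
-- x₂ are distinct, and v, w or a third vertex z (here n ≥ 3 is used) is adjacent to
-- neither of them.
module Submission where

open import Defs
open import Data.Nat using (ℕ; zero; suc; _+_; _≤_; _≡ᵇ_; z≤n; s≤s)
open import Data.Nat.Properties
  using (≤-trans; ≤-refl; ≤-antisym; ≤-reflexive; <⇒≱; +-suc; n≤1+n; +-monoʳ-≤)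
open import Data.Fin using (Fin; zero; suc; toℕ; fromℕ; inject₁; splitAt; _≟_; _↑ˡ_; _↑ʳ_)
open import Data.Fin.Properties
  using ( splitAt-↑ˡ; splitAt-↑ʳ; splitAt⁻¹-↑ˡ; splitAt⁻¹-↑ʳ; ↑ˡ-injective; ↑ʳ-injective
        ; toℕ-fromℕ; toℕ-inject₁)
open import Data.Fin.Subset using (Subset; _∈_; ∣_∣; ⁅_⁆; _∪_; _-_; inside; outside)
open import Data.Fin.Subset.Properties
  using (x∈⁅x⁆; p⊆p∪q; q⊆p∪q; x∈p⇒∣p-x∣<∣p∣; x∈p∧x≢y⇒x∈p-y; ∣⁅x⁆∣≡1)
open import Data.Vec using (_∷_; [])
open import Data.Bool using (true; false; _∧_; _∨_; not)
open import Data.Bool.Properties using (∨-comm; ∧-comm; ∧-zeroʳ; ∨-zeroʳ; not-¬)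
open import Data.Sum using (_⊎_; inj₁; inj₂; [_,_]′)
open import Data.Product using (∃-syntax; _×_; _,_)
open import Function using (_∘_)
open import Relation.Nullary using (¬_; yes; no; contradiction)
open import Relation.Nullary.Decidable using (isYes)
open import Relation.Binary.PropositionalEquality as ≡
  using (_≡_; _≢_; refl; cong; cong₂; subst; ≢-sym)

∣p∪q∣≤∣p∣+∣q∣ : ∀ {m} (p q : Subset m) → ∣ p ∪ q ∣ ≤ ∣ p ∣ + ∣ q ∣
∣p∪q∣≤∣p∣+∣q∣ []            []            = z≤n
∣p∪q∣≤∣p∣+∣q∣ (inside  ∷ p) (inside  ∷ q) =
  s≤s (≤-trans (∣p∪q∣≤∣p∣+∣q∣ p q) (+-monoʳ-≤ ∣ p ∣ (n≤1+n ∣ q ∣)))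
∣p∪q∣≤∣p∣+∣q∣ (inside  ∷ p) (outside ∷ q) = s≤s (∣p∪q∣≤∣p∣+∣q∣ p q)
∣p∪q∣≤∣p∣+∣q∣ (outside ∷ p) (inside  ∷ q) =
  ≤-trans (s≤s (∣p∪q∣≤∣p∣+∣q∣ p q)) (≤-reflexive (≡.sym (+-suc ∣ p ∣ ∣ q ∣)))
∣p∪q∣≤∣p∣+∣q∣ (outside ∷ p) (outside ∷ q) = ∣p∪q∣≤∣p∣+∣q∣ p q

∣⁅x⁆∪⁅y⁆∣≤2 : ∀ {m} (x y : Fin m) → ∣ ⁅ x ⁆ ∪ ⁅ y ⁆ ∣ ≤ 2
∣⁅x⁆∪⁅y⁆∣≤2 x y = ≤-trans (∣p∪q∣≤∣p∣+∣q∣ ⁅ x ⁆ ⁅ y ⁆)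
  (≤-reflexive (cong₂ _+_ (∣⁅x⁆∣≡1 x) (∣⁅x⁆∣≡1 y)))

∣⁅x⁆∪⁅y⁆∪⁅z⁆∣≤3 : ∀ {m} (x y z : Fin m) → ∣ ⁅ x ⁆ ∪ ⁅ y ⁆ ∪ ⁅ z ⁆ ∣ ≤ 3
∣⁅x⁆∪⁅y⁆∪⁅z⁆∣≤3 x y z = ≤-trans (∣p∪q∣≤∣p∣+∣q∣ ⁅ x ⁆ (⁅ y ⁆ ∪ ⁅ z ⁆))
  (≤-trans (+-monoʳ-≤ ∣ ⁅ x ⁆ ∣ (∣⁅x⁆∪⁅y⁆∣≤2 y z)) (≤-reflexive (cong (_+ 2) (∣⁅x⁆∣≡1 x))))

x∈⁅x⁆∪q : ∀ {m} (x : Fin m) (q : Subset m) → x ∈ ⁅ x ⁆ ∪ q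
x∈⁅x⁆∪q x q = p⊆p∪q q (x∈⁅x⁆ x)

x∈p⇒1+∣p-x∣≤∣p∣ : ∀ {m k} {x : Fin m} {p : Subset m} → x ∈ p → k ≤ ∣ p - x ∣ → suc k ≤ ∣ p ∣
x∈p⇒1+∣p-x∣≤∣p∣ x∈p k≤∣p-x∣ = ≤-trans (s≤s k≤∣p-x∣) (x∈p⇒∣p-x∣<∣p∣ x∈p)

distinct⇒2≤∣p∣ : ∀ {m} {x y : Fin m} {p : Subset m} → x ∈ p → y ∈ p → x ≢ y → 2 ≤ ∣ p ∣
distinct⇒2≤∣p∣ x∈p y∈p x≢y =
  x∈p⇒1+∣p-x∣≤∣p∣ x∈p (x∈p⇒1+∣p-x∣≤∣p∣ (x∈p∧x≢y⇒x∈p-y y∈p (≢-sym x≢y)) z≤n)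

distinct⇒3≤∣p∣ : ∀ {m} {x y z : Fin m} {p : Subset m} → x ∈ p → y ∈ p → z ∈ p →
                 x ≢ y → x ≢ z → y ≢ z → 3 ≤ ∣ p ∣
distinct⇒3≤∣p∣ x∈p y∈p z∈p x≢y x≢z y≢z = x∈p⇒1+∣p-x∣≤∣p∣ x∈p
  (distinct⇒2≤∣p∣ (x∈p∧x≢y⇒x∈p-y y∈p (≢-sym x≢y)) (x∈p∧x≢y⇒x∈p-y z∈p (≢-sym x≢z)) y≢z)

IsGammaT-intro : ∀ {m} {A : Adjacency m} {k} (S : Subset m) → IsTDS A S → ∣ S ∣ ≤ k →
                 (∀ S′ → IsTDS A S′ → k ≤ ∣ S′ ∣) → IsGammaT A k
IsGammaT-intro S S-tds ∣S∣≤k minimal = (S , S-tds , ≤-antisym ∣S∣≤k (minimal S S-tds)) , minimal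

adjacent⇒≢ : ∀ {n} (G : Graph n) {x y} → Adj G x y ≡ true → x ≢ y
adjacent⇒≢ G {x} xy refl = contradiction (≡.trans (≡.sym (irrefl G x)) xy) λ ()

tds⇒2≤∣S∣ : ∀ {n} (G : Graph n) {S} → Fin n → IsTDS (Adj G) S → 2 ≤ ∣ S ∣
tds⇒2≤∣S∣ G x S-tds with S-tds x
... | y , y∈S , _ with S-tds y
...   | z , z∈S , yz = distinct⇒2≤∣p∣ y∈S z∈S (adjacent⇒≢ G yz)

tds⇒3≤∣S∣ : ∀ {m} {A : Adjacency m} {S p q} → IsTDS A S → p ∈ S → q ∈ S → p ≢ q →
            (y : Fin m) → A y p ≡ false → A y q ≡ false → 3 ≤ ∣ S ∣
tds⇒3≤∣S∣ {A = A} S-tds p∈S q∈S p≢q y yp yq with S-tds y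
... | r , r∈S , yr = distinct⇒3≤∣p∣ p∈S q∈S r∈S p≢q (≢-by yp) (≢-by yq)
  where
  ≢-by : ∀ {x} → A y x ≡ false → x ≢ r
  ≢-by yx refl = contradiction (≡.trans (≡.sym yx) yr) λ ()

data Split (m n : ℕ) : Fin (m + n) → Set where
  old : (a : Fin m) → Split m n (a ↑ˡ n)
  new : (k : Fin n) → Split m n (m ↑ʳ k)

split : ∀ m {n} (i : Fin (m + n)) → Split m n i
split m i with splitAt m i in eq
... | inj₁ a = subst (Split m _) (splitAt⁻¹-↑ˡ eq) (old a)
... | inj₂ k = subst (Split m _) (splitAt⁻¹-↑ʳ eq) (new k)

↑ˡ≢↑ʳ : ∀ {m n} (a : Fin m) (k : Fin n) → a ↑ˡ n ≢ m ↑ʳ k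
↑ˡ≢↑ʳ {m} {n} a k eq
  with ≡.trans (≡.sym (splitAt-↑ˡ m a n)) (≡.trans (cong (splitAt m) eq) (splitAt-↑ʳ m n k))
... | ()

m≡ᵇ1+m : ∀ m → (m ≡ᵇ suc m) ≡ false
m≡ᵇ1+m zero    = refl
m≡ᵇ1+m (suc m) = m≡ᵇ1+m m

m≡ᵇm : ∀ m → (m ≡ᵇ m) ≡ true
m≡ᵇm zero    = refl
m≡ᵇm (suc m) = m≡ᵇm m

module Subdivision {n : ℕ} (G : Graph n) (u v : Fin n) where

  private
    A = Adj G

    ≡ᵇ-swap : ∀ p q → (p ≡ᵇ suc q) ∨ (q ≡ᵇ suc p) ≡ (q ≡ᵇ suc p) ∨ (p ≡ᵇ suc q)
    ≡ᵇ-swap p q = ∨-comm (p ≡ᵇ suc q) _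

    kept-sym : ∀ a b p q r s →
               A a b ∧ not ((p ∧ s) ∨ (q ∧ r)) ≡ A b a ∧ not ((r ∧ q) ∨ (s ∧ p))
    kept-sym a b p q r s
      rewrite Graph.sym G a b | ∧-comm p s | ∧-comm q r | ∨-comm (s ∧ p) (r ∧ q) = refl

  -- Deciding membership in {u, v} makes the path positions of x and y compute; the
  -- surviving-edge part is then kept-sym, and the path part is commutativity of ∨.
  subdivide-sym : ∀ t x y → subdivide A u v t x y ≡ subdivide A u v t y x
  subdivide-sym t x y with splitAt n x | splitAt n y
  ... | inj₁ a | inj₁ b with a ≟ u | a ≟ v | b ≟ u | b ≟ v
  ...   | yes _ | av    | yes _ | bv    = cong (_∨ _) (kept-sym a b true (isYes av) true (isYes bv))
  ...   | yes _ | av    | no _  | yes _ =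
    cong₂ _∨_ (kept-sym a b true (isYes av) false true) (≡ᵇ-swap 0 (suc t))
  ...   | yes _ | av    | no _  | no _  = cong (_∨ _) (kept-sym a b true (isYes av) false false)
  ...   | no _  | yes _ | yes _ | bv    =
    cong₂ _∨_ (kept-sym a b false true true (isYes bv)) (≡ᵇ-swap (suc t) 0)
  ...   | no _  | yes _ | no _  | yes _ = cong (_∨ _) (kept-sym a b false true false true)
  ...   | no _  | yes _ | no _  | no _  = cong (_∨ _) (kept-sym a b false true false false)
  ...   | no _  | no _  | yes _ | bv    = cong (_∨ _) (kept-sym a b false false true (isYes bv))
  ...   | no _  | no _  | no _  | yes _ = cong (_∨ _) (kept-sym a b false false false true)
  ...   | no _  | no _  | no _  | no _  = cong (_∨ _) (kept-sym a b false false false false)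
  subdivide-sym t x y | inj₁ a | inj₂ k with a ≟ u | a ≟ v
  ...   | yes _ | _     = ≡ᵇ-swap 0 (suc (toℕ k))
  ...   | no _  | yes _ = ≡ᵇ-swap (suc t) (suc (toℕ k))
  ...   | no _  | no _  = refl
  subdivide-sym t x y | inj₂ k | inj₁ a with a ≟ u | a ≟ v
  ...   | yes _ | _     = ≡ᵇ-swap (suc (toℕ k)) 0
  ...   | no _  | yes _ = ≡ᵇ-swap (suc (toℕ k)) (suc t)
  ...   | no _  | no _  = refl
  subdivide-sym t x y | inj₂ j | inj₂ k = ≡ᵇ-swap (suc (toℕ j)) (suc (toℕ k))

  subdivide-irrefl : ∀ t x → subdivide A u v t x x ≡ false
  subdivide-irrefl t x with splitAt n x
  ... | inj₁ a rewrite irrefl G a with a ≟ u | a ≟ v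
  ...   | yes _ | _     = refl
  ...   | no _  | yes _ = cong₂ _∨_ (m≡ᵇ1+m (suc t)) (m≡ᵇ1+m (suc t))
  ...   | no _  | no _  = refl
  subdivide-irrefl t x | inj₂ k = cong₂ _∨_ (m≡ᵇ1+m (suc (toℕ k))) (m≡ᵇ1+m (suc (toℕ k)))


  ↑ˡ-adjacent : ∀ t {a b} → a ≢ u → a ≢ v → A a b ≡ true →
                subdivide A u v t (a ↑ˡ t) (b ↑ˡ t) ≡ true
  ↑ˡ-adjacent t {a} {b} a≢u a≢v ab rewrite splitAt-↑ˡ n a t | splitAt-↑ˡ n b t
    with a ≟ u | a ≟ v
  ... | yes a≡u | _       = contradiction a≡u a≢u
  ... | no _    | yes a≡v = contradiction a≡v a≢v
  ... | no _    | no _    rewrite ab = refl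

  u≁v : ∀ t → subdivide A u v (suc t) (u ↑ˡ suc t) (v ↑ˡ suc t) ≡ false
  u≁v t rewrite splitAt-↑ˡ n u (suc t) | splitAt-↑ˡ n v (suc t) with u ≟ u | v ≟ v | v ≟ u
  ... | yes _ | yes _ | yes _ = cong (_∨ false) (∧-zeroʳ (A u v))
  ... | yes _ | yes _ | no _  = cong (_∨ false) (∧-zeroʳ (A u v))
  ... | no u≢u | _    | _     = contradiction refl u≢u
  ... | yes _ | no v≢v | _    = contradiction refl v≢v

  u∼x₁ : ∀ t → subdivide A u v (suc t) (u ↑ˡ suc t) (n ↑ʳ zero) ≡ true
  u∼x₁ t rewrite splitAt-↑ˡ n u (suc t) | splitAt-↑ʳ n (suc t) zero with u ≟ u
  ... | yes _   = refl
  ... | no u≢u = contradiction refl u≢u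

  v∼xₜ : ∀ t → u ≢ v → subdivide A u v (suc t) (v ↑ˡ suc t) (n ↑ʳ fromℕ t) ≡ true
  v∼xₜ t u≢v rewrite splitAt-↑ˡ n v (suc t) | splitAt-↑ʳ n (suc t) (fromℕ t) | toℕ-fromℕ t
    with v ≟ u | v ≟ v
  ... | yes v≡u | _      = contradiction (≡.sym v≡u) u≢v
  ... | no _    | yes _  rewrite m≡ᵇm t = refl
  ... | no _    | no v≢v = contradiction refl v≢v

  xₖ∼xₖ₊₁ : ∀ {t} (k : Fin t) → subdivide A u v (suc t) (n ↑ʳ inject₁ k) (n ↑ʳ suc k) ≡ true
  xₖ∼xₖ₊₁ {t} k rewrite splitAt-↑ʳ n (suc t) (inject₁ k) | splitAt-↑ʳ n (suc t) (suc k)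
                      | toℕ-inject₁ k | m≡ᵇm (toℕ k) = ∨-zeroʳ _

  x₁ x₂ : Fin (n + 2)
  x₁ = n ↑ʳ zero
  x₂ = n ↑ʳ suc zero

  ↑ˡ≁x₁ : ∀ {a} → a ≢ u → subdivide A u v 2 (a ↑ˡ 2) x₁ ≡ false
  ↑ˡ≁x₁ {a} a≢u rewrite splitAt-↑ˡ n a 2 | splitAt-↑ʳ n 2 (zero {1}) with a ≟ u | a ≟ v
  ... | yes a≡u | _     = contradiction a≡u a≢u
  ... | no _    | yes _ = refl
  ... | no _    | no _  = refl

  ↑ˡ≁x₂ : ∀ {a} → a ≢ v → subdivide A u v 2 (a ↑ˡ 2) x₂ ≡ false
  ↑ˡ≁x₂ {a} a≢v rewrite splitAt-↑ˡ n a 2 | splitAt-↑ʳ n 2 (suc (zero {0})) with a ≟ u | a ≟ v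
  ... | yes _ | _       = refl
  ... | no _  | yes a≡v = contradiction a≡v a≢v
  ... | no _  | no _    = refl

  x₁-neighbours : ∀ {y} → subdivide A u v 2 x₁ y ≡ true → y ≡ u ↑ˡ 2 ⊎ y ≡ x₂
  x₁-neighbours {y} x₁y with split n y
  ... | new zero       = contradiction x₁y (not-¬ (subdivide-irrefl 2 x₁))
  ... | new (suc zero) = inj₂ refl
  ... | old a with a ≟ u
  ...   | yes refl = inj₁ refl
  ...   | no a≢u   = contradiction (≡.trans (subdivide-sym 2 _ _) x₁y) (not-¬ (↑ˡ≁x₁ a≢u))

  x₂-neighbours : ∀ {y} → subdivide A u v 2 x₂ y ≡ true → y ≡ x₁ ⊎ y ≡ v ↑ˡ 2
  x₂-neighbours {y} x₂y with split n y
  ... | new zero       = inj₁ refl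
  ... | new (suc zero) = contradiction x₂y (not-¬ (subdivide-irrefl 2 x₂))
  ... | old a with a ≟ v
  ...   | yes refl = inj₂ refl
  ...   | no a≢v   = contradiction (≡.trans (subdivide-sym 2 _ _) x₂y) (not-¬ (↑ˡ≁x₂ a≢v))

module UniversalVertex {n : ℕ} (G : Graph n) {w : Fin n} (U : IsUniversal G w) where

  ∼w : ∀ {a} → a ≢ w → Adj G a w ≡ true
  ∼w {a} a≢w = ≡.trans (Graph.sym G a w) (U a a≢w)

  γₜ≡2 : ∀ {v} → v ≢ w → IsGammaT (Adj G) 2
  γₜ≡2 {v} v≢w =
    IsGammaT-intro (⁅ w ⁆ ∪ ⁅ v ⁆) dominating (∣⁅x⁆∪⁅y⁆∣≤2 w v) (λ _ → tds⇒2≤∣S∣ G w)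
    where
    dominating : IsTDS (Adj G) (⁅ w ⁆ ∪ ⁅ v ⁆)
    dominating a with a ≟ w
    ... | yes refl = v , q⊆p∪q ⁅ w ⁆ ⁅ v ⁆ (x∈⁅x⁆ v) , U v v≢w
    ... | no a≢w   = w , x∈⁅x⁆∪q w ⁅ v ⁆ , ∼w a≢w

  module _ (u v : Fin n) (uv : Adj G u v ≡ true) where
    open Subdivision G u v

    endpoint-dominates : w ≡ u ⊎ w ≡ v → ∀ t a →
      subdivide (Adj G) u v (suc t) (a ↑ˡ suc t) (w ↑ˡ suc t) ≡ true ⊎
      subdivide (Adj G) u v (suc t) (a ↑ˡ suc t) (n ↑ʳ zero) ≡ true ⊎
      subdivide (Adj G) u v (suc t) (a ↑ˡ suc t) (n ↑ʳ fromℕ t) ≡ true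
    endpoint-dominates w∈uv t a with a ≟ u | a ≟ v
    ... | yes refl | _        = inj₂ (inj₁ (u∼x₁ t))
    ... | no _     | yes refl = inj₂ (inj₂ (v∼xₜ t (adjacent⇒≢ G uv)))
    ... | no a≢u   | no a≢v   = inj₁ (↑ˡ-adjacent (suc t) a≢u a≢v (∼w a≢w))
      where
      a≢w : a ≢ w
      a≢w refl = [ a≢u , a≢v ]′ w∈uv

    endpoint-tds : w ≡ u ⊎ w ≡ v → ∃[ S ] IsTDS (subdivide (Adj G) u v 1) S × ∣ S ∣ ≤ 2
    endpoint-tds w∈uv = ⁅ w ↑ˡ 1 ⁆ ∪ ⁅ n ↑ʳ zero ⁆ , dominating , ∣⁅x⁆∪⁅y⁆∣≤2 (w ↑ˡ 1) _
      where
      w∼x₁ : subdivide (Adj G) u v 1 (w ↑ˡ 1) (n ↑ʳ zero) ≡ true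
      w∼x₁ = [ (λ { refl → u∼x₁ 0 }) , (λ { refl → v∼xₜ 0 (adjacent⇒≢ G uv) }) ]′ w∈uv

      dominating : IsTDS (subdivide (Adj G) u v 1) (⁅ w ↑ˡ 1 ⁆ ∪ ⁅ n ↑ʳ zero ⁆)
      dominating x with split n x
      ... | new zero = w ↑ˡ 1 , x∈⁅x⁆∪q _ _ , ≡.trans (subdivide-sym 1 _ _) w∼x₁
      ... | old a with endpoint-dominates w∈uv 0 a
      ...   | inj₁ aw        = w ↑ˡ 1 , x∈⁅x⁆∪q _ _ , aw
      ...   | inj₂ (inj₁ ax) = n ↑ʳ zero , q⊆p∪q _ _ (x∈⁅x⁆ _) , ax
      ...   | inj₂ (inj₂ ax) = n ↑ʳ zero , q⊆p∪q _ _ (x∈⁅x⁆ _) , ax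

    off-edge-tds : w ≢ u → w ≢ v → ∃[ S ] IsTDS (subdivide (Adj G) u v 1) S × ∣ S ∣ ≤ 2
    off-edge-tds w≢u w≢v = ⁅ w ↑ˡ 1 ⁆ ∪ ⁅ u ↑ˡ 1 ⁆ , dominating , ∣⁅x⁆∪⁅y⁆∣≤2 (w ↑ˡ 1) _
      where
      dominating : IsTDS (subdivide (Adj G) u v 1) (⁅ w ↑ˡ 1 ⁆ ∪ ⁅ u ↑ˡ 1 ⁆)
      dominating x with split n x
      ... | new zero = u ↑ˡ 1 , q⊆p∪q _ _ (x∈⁅x⁆ _) , ≡.trans (subdivide-sym 1 _ _) (u∼x₁ 0)
      ... | old a with a ≟ w
      ...   | yes refl = u ↑ˡ 1 , q⊆p∪q _ _ (x∈⁅x⁆ _) , ↑ˡ-adjacent 1 w≢u w≢v (U u (≢-sym w≢u))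
      ...   | no a≢w   = w ↑ˡ 1 , x∈⁅x⁆∪q _ _ ,
                         ≡.trans (subdivide-sym 1 _ _) (↑ˡ-adjacent 1 w≢u w≢v (U a a≢w))

    tds-of-size-2 : ∃[ S ] IsTDS (subdivide (Adj G) u v 1) S × ∣ S ∣ ≤ 2
    tds-of-size-2 with w ≟ u | w ≟ v
    ... | yes w≡u | _       = endpoint-tds (inj₁ w≡u)
    ... | no _    | yes w≡v = endpoint-tds (inj₂ w≡v)
    ... | no w≢u  | no w≢v  = off-edge-tds w≢u w≢v

    ¬Increases₁ : ¬ Increases G u v 1
    ¬Increases₁ (k , k′ , ((S , S-tds , ∣S∣≡k) , _) , (_ , k′-minimal) , k<k′)
      with tds-of-size-2
    ... | S₁ , S₁-tds , ∣S₁∣≤2 =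
      <⇒≱ k<k′ (≤-trans (k′-minimal S₁ S₁-tds) (≤-trans ∣S₁∣≤2 2≤k))
      where
      2≤k : 2 ≤ k
      2≤k = subst (2 ≤_) ∣S∣≡k (tds⇒2≤∣S∣ G u S-tds)

  module _ {v z : Fin n} (v≢w : v ≢ w) (z≢w : z ≢ w) (z≢v : z ≢ v) where
    open Subdivision G w v

    private
      S₂ : Subset (n + 2)
      S₂ = ⁅ w ↑ˡ 2 ⁆ ∪ ⁅ x₁ ⁆ ∪ ⁅ x₂ ⁆

      x₁∈S₂ : x₁ ∈ S₂
      x₁∈S₂ = q⊆p∪q _ _ (x∈⁅x⁆∪q x₁ _)

      dominating : IsTDS (subdivide (Adj G) w v 2) S₂
      dominating x with split n x
      ... | new zero       = w ↑ˡ 2 , x∈⁅x⁆∪q _ _ , ≡.trans (subdivide-sym 2 _ _) (u∼x₁ 1)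
      ... | new (suc zero) = x₁ , x₁∈S₂ , ≡.trans (subdivide-sym 2 _ _) (xₖ∼xₖ₊₁ zero)
      ... | old a with endpoint-dominates w v (U v v≢w) (inj₁ refl) 1 a
      ...   | inj₁ aw        = w ↑ˡ 2 , x∈⁅x⁆∪q _ _ , aw
      ...   | inj₂ (inj₁ ax) = x₁ , x₁∈S₂ , ax
      ...   | inj₂ (inj₂ ax) = x₂ , q⊆p∪q _ _ (q⊆p∪q _ _ (x∈⁅x⁆ x₂)) , ax

      -- The dominators p of x₁ and q of x₂ are distinct, and in each of the four
      -- cases some vertex is adjacent to neither, forcing a third vertex into S.
      3≤∣S∣ : ∀ S → IsTDS (subdivide (Adj G) w v 2) S → 3 ≤ ∣ S ∣
      3≤∣S∣ S S-tds with S-tds x₁ | S-tds x₂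
      ... | p , p∈S , x₁p | q , q∈S , x₂q with x₁-neighbours x₁p | x₂-neighbours x₂q
      ... | inj₁ refl | inj₁ refl = tds⇒3≤∣S∣ S-tds p∈S q∈S (↑ˡ≢↑ʳ w zero)
        (v ↑ˡ 2) (≡.trans (subdivide-sym 2 _ _) (u≁v 1)) (↑ˡ≁x₁ v≢w)
      ... | inj₁ refl | inj₂ refl = tds⇒3≤∣S∣ S-tds p∈S q∈S (v≢w ∘ ≡.sym ∘ ↑ˡ-injective 2 w v)
        (w ↑ˡ 2) (subdivide-irrefl 2 _) (u≁v 1)
      ... | inj₂ refl | inj₁ refl = tds⇒3≤∣S∣ S-tds p∈S q∈S (x₂≢x₁ ∘ ↑ʳ-injective n (suc zero) zero)
        (z ↑ˡ 2) (↑ˡ≁x₂ z≢v) (↑ˡ≁x₁ z≢w)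
        where
        x₂≢x₁ : suc zero ≢ zero {1}
        x₂≢x₁ ()
      ... | inj₂ refl | inj₂ refl = tds⇒3≤∣S∣ S-tds p∈S q∈S (≢-sym (↑ˡ≢↑ʳ v (suc zero)))
        (w ↑ˡ 2) (↑ˡ≁x₂ (≢-sym v≢w)) (u≁v 1)

    γₜ-subdivided-twice≡3 : IsGammaT (subdivide (Adj G) w v 2) 3
    γₜ-subdivided-twice≡3 = IsGammaT-intro S₂ dominating (∣⁅x⁆∪⁅y⁆∪⁅z⁆∣≤3 (w ↑ˡ 2) x₁ x₂) 3≤∣S∣

msd-edge≡2 : ∀ {n} (G : Graph n) {u v} →
             Increases G u v 2 → ¬ Increases G u v 1 → IsMsdEdge G u v 2
msd-edge≡2 _ inc₂ ¬inc₁ = s≤s z≤n , inc₂ , λ where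
  1             _ _                 → ¬inc₁
  (suc (suc _)) _ (s≤s (s≤s ()))

msd-edge-≥2 : ∀ {n} (G : Graph n) {u v t} → ¬ Increases G u v 1 → IsMsdEdge G u v t → 2 ≤ t
msd-edge-≥2 _ {t = 1}           ¬inc₁ (_ , inc₁ , _) = contradiction inc₁ ¬inc₁
msd-edge-≥2 _ {t = suc (suc _)} _     _              = s≤s (s≤s z≤n)

avoid₂ : ∀ {n} → 3 ≤ n → (x y : Fin n) → ∃[ z ] z ≢ x × z ≢ y
avoid₂ (s≤s (s≤s (s≤s _))) zero           zero           = suc zero , (λ ()) , (λ ())
avoid₂ (s≤s (s≤s (s≤s _))) zero           (suc zero)     = suc (suc zero) , (λ ()) , (λ ())
avoid₂ (s≤s (s≤s (s≤s _))) zero           (suc (suc _))  = suc zero , (λ ()) , (λ ())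
avoid₂ (s≤s (s≤s (s≤s _))) (suc zero)     zero           = suc (suc zero) , (λ ()) , (λ ())
avoid₂ (s≤s (s≤s (s≤s _))) (suc zero)     (suc _)        = zero , (λ ()) , (λ ())
avoid₂ (s≤s (s≤s (s≤s _))) (suc (suc _))  zero           = suc zero , (λ ()) , (λ ())
avoid₂ (s≤s (s≤s (s≤s _))) (suc (suc _))  (suc _)        = zero , (λ ()) , (λ ())

lemma4 : ∀ (n : ℕ) (G : Graph n) → 3 ≤ n → ∃[ w ] IsUniversal G w → IsMsd G 2
lemma4 n G 3≤n (w , U) with avoid₂ 3≤n w w
... | v , v≢w , _ with avoid₂ 3≤n w v
...   | z , z≢w , z≢v = (w , v , U v v≢w , msd-edge≡2 G increases₂ (¬Increases₁ w v (U v v≢w)))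
                      , λ a b ab _ → msd-edge-≥2 G (¬Increases₁ a b ab)
  where
  open UniversalVertex G U
  increases₂ : Increases G w v 2
  increases₂ = 2 , 3 , γₜ≡2 v≢w , γₜ-subdivided-twice≡3 v≢w z≢w z≢v , ≤-refl
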